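{- Let $A = \langle Q, \Sigma, \mathbb{E}, \rightarrow, q^0, t\rangle$ be a Soft Component Automaton and let $\sigma \in \Sigma^\pi\cup\Sigma^*$. If $\sigma\in L(A)$, or $\sigma$ is a finite prefix of some $\tau\in L(A)$, then $t \le_{\mathbb{E}} d_A(\sigma)$.
   Context: A c-semiring $\langle \mathbb{E}, \bigoplus, \otimes, \mathbf{0}, \mathbf{1}\rangle$: $\bigoplus:2^{\mathbb{E}}\to\mathbb{E}$ with $\bigoplus\emptyset=\mathbf{0}$, $\bigoplus\mathbb{E}=\mathbf{1}$, $\bigoplus\{e\}=e$, $\bigoplus\{\bigoplus E:E\in\mathcal{E}\}=\bigoplus\bigcup\mathcal{E}$; $\otimes$ commutative, associative, $e\otimes\mathbf{0}=\mathbf{0}$, $e\otimes\mathbf{1}=e$, $e\otimes\bigoplus E=\bigoplus\{e\otimes e':e'\in E\}$. The order $e\le_{\mathbb{E}} e'$ iff $\bigoplus\{e,e'\}=e'$ makes $\mathbb{E}$ a complete lattice with join $\bigoplus$ and meet $\bigwedge$. A Soft Component Automaton (SCA) $\langle Q,\Sigma,\mathbb{E},\rightarrow,q^0,t\rangle$ has a finite state set $Q$, initial state $q^0$, a finite set of actions $\Sigma$ (part of a Component Action System), a c-semiring $\mathbb{E}$, threshold $t\in\mathbb{E}$, and finite transition relation $\rightarrow\subseteq Q\times\Sigma\times\mathbb{E}\times Q$, written $q\xrightarrow{a,e}q'$. $L(A)$ is the set of $\sigma\in\Sigma^\omega$ for which there exist $\mu\in Q^\omega,\nu\in\mathbb{E}^\omega$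 with $\mu(0)=q^0$ and, for all $n$, $t\le\nu(n)$ and $\mu(n)\xrightarrow{\sigma(n),\nu(n)}\mu(n+1)$. $\Sigma^*$ is finite words, $\Sigma^\pi$ eventually periodic streams, $|\sigma|$ the length ($\omega$ for streams). Diagnostic preference: $Q_0=\{q^0\}$, and for $n<|\sigma|$, $Q_{n+1}=\{q' : q\in Q_n,\ q\xrightarrow{\sigma(n),e}q'\}$; $\xi(n)=\bigoplus\{e: q\in Q_n,\ q\xrightarrow{\sigma(n),e}q'\}$ for $n<|\sigma|$; and $d_A(\sigma)=\bigwedge\{\xi(n): n<|\sigma|\}$. -}

module Defs where

open import Data.Nat using (ℕ; zero; suc; _<_; _≤_; _+_)
open import Data.Fin using (Fin; fromℕ<)
open import Data.List using (List; length; lookup)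
open import Data.List.Membership.Propositional using (_∈_)
open import Data.Product using (Σ; _×_; _,_; ∃)
open import Data.Sum using (_⊎_)
open import Data.Unit using (⊤)
open import Data.Empty using (⊥)
open import Relation.Binary.PropositionalEquality using (_≡_)

Subset : Set → Set₁
Subset A = A → Set

-- c-semirings, following the paper's axioms.
-- Families of subsets {E : E ∈ 𝓔} are given as indexed families I → Subset.

record CSemiring : Set₁ where
  field
    Carrier : Set
    ⨁       : Subset Carrier → Carrier
    _⊗_     : Carrier → Carrier → Carrier
    𝟘 𝟙     : Carrier

  ∅ : Subset Carrier
  ∅ _ = ⊥

  full : Subset Carrier
  full _ = ⊤

  ⟦_⟧ : Carrier → Subset Carrier
  ⟦ e ⟧ x = x ≡ e

  field
    -- ⨁ is a function on subsets (extensional in the subset)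
    ⨁-ext      : (S S′ : Subset Carrier) →
                 (∀ x → S x → S′ x) → (∀ x → S′ x → S x) → ⨁ S ≡ ⨁ S′
    ⨁-empty    : ⨁ ∅ ≡ 𝟘
    ⨁-full     : ⨁ full ≡ 𝟙
    ⨁-singleton : ∀ e → ⨁ ⟦ e ⟧ ≡ e
    ⨁-flatten  : (I : Set) (F : I → Subset Carrier) →
                 ⨁ (λ x → Σ I λ i → ⨁ (F i) ≡ x) ≡ ⨁ (λ x → Σ I λ i → F i x)
    ⊗-comm     : ∀ a b → a ⊗ b ≡ b ⊗ a
    ⊗-assoc    : ∀ a b c → (a ⊗ b) ⊗ c ≡ a ⊗ (b ⊗ c)
    ⊗-zero     : ∀ e → e ⊗ 𝟘 ≡ 𝟘
    ⊗-one      : ∀ e → e ⊗ 𝟙 ≡ e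
    ⊗-distrib  : ∀ e (S : Subset Carrier) →
                 e ⊗ ⨁ S ≡ ⨁ (λ x → Σ Carrier λ e′ → S e′ × (e ⊗ e′ ≡ x))

  _≤E_ : Carrier → Carrier → Set
  e ≤E e′ = ⨁ (λ x → x ≡ e ⊎ x ≡ e′) ≡ e′

  ⋀ : Subset Carrier → Carrier
  ⋀ S = ⨁ (λ x → ∀ y → S y → x ≤E y)

record SCA (E : CSemiring) (nΣ : ℕ) : Set where
  open CSemiring E
  field
    nQ  : ℕ                                    -- Q = Fin nQ (finite)
    δ   : List (Fin nQ × Fin nΣ × Carrier × Fin nQ)
    q⁰  : Fin nQ
    t   : Carrier

data Word (A : Set) : Set where
  fin : List A → Word A
  str : (ℕ → A) → Word A

_<ℓ_ : {A : Set} → ℕ → Word A → Set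
n <ℓ fin w = n < length w
n <ℓ str s = ⊤

at : {A : Set} (σ : Word A) (n : ℕ) → n <ℓ σ → A
at (fin w) n p = lookup w (fromℕ< p)
at (str s) n _ = s n

EventuallyPeriodic : {A : Set} → (ℕ → A) → Set
EventuallyPeriodic s = Σ ℕ λ k → Σ ℕ λ p → (0 < p) × (∀ n → k ≤ n → s (n + p) ≡ s n)

PiOrStar : {A : Set} → Word A → Set
PiOrStar (fin _) = ⊤
PiOrStar (str s) = EventuallyPeriodic s

module _ {E : CSemiring} {nΣ : ℕ} (A : SCA E nΣ) where
  open CSemiring E
  open SCA A

  InL : (ℕ → Fin nΣ) → Set
  InL σ = Σ (ℕ → Fin nQ) λ μ → Σ (ℕ → Carrier) λ ν →
            (μ 0 ≡ q⁰) × (∀ n → (t ≤E ν n) × ((μ n , σ n , ν n , μ (suc n)) ∈ δ))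

  WordInL : Word (Fin nΣ) → Set
  WordInL (fin _) = ⊥
  WordInL (str s) = InL s

  PrefixOfL : Word (Fin nΣ) → Set
  PrefixOfL (fin w) = Σ (ℕ → Fin nΣ) λ τ → InL τ × (∀ i → lookup w i ≡ τ (Data.Fin.toℕ i))
  PrefixOfL (str _) = ⊥

  data Reach (σ : Word (Fin nΣ)) : ℕ → Fin nQ → Set where
    reach0 : Reach σ 0 q⁰
    reachS : ∀ {n q q′ e} → Reach σ n q → (p : n <ℓ σ) →
             (q , at σ n p , e , q′) ∈ δ → Reach σ (suc n) q′

  ξ : (σ : Word (Fin nΣ)) (n : ℕ) → n <ℓ σ → Carrier
  ξ σ n p = ⨁ (λ e → Σ (Fin nQ) λ q → Σ (Fin nQ) λ q′ →
                   Reach σ n q × ((q , at σ n p , e , q′) ∈ δ))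

  d : Word (Fin nΣ) → Carrier
  d σ = ⋀ (λ x → Σ ℕ λ n → Σ (n <ℓ σ) λ p → ξ σ n p ≡ x)

module Submission where

-- Call an accepting run along σ a state sequence μ
-- starting in q⁰ together with weights ν, all above the threshold t, such
-- that every step n < |σ| is a transition reading σ(n).  Such a run only
-- visits reachable states, μ(n) ∈ Q_n, so its weight ν(n) is one of the
-- values joined in ξ(n); hence t ≤ ν(n) ≤ ξ(n) for every n < |σ|, and t is
-- a lower bound of the ξ(n), i.e. t ≤ d_A(σ).  Both hypotheses of the
-- theorem provide such a run: a stream in L(A) by definition, a finite
-- prefix of τ ∈ L(A) by restricting the run of τ.

open import Defs
open import Data.Nat using (ℕ; zero; suc; _<_)
open import Data.Nat.Properties using (<-trans; n<1+n)
open import Data.Fin using (Fin; fromℕ<)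
open import Data.Fin.Properties using (toℕ-fromℕ<)
open import Data.Bool using (Bool; true; false)
open import Data.List using (List; lookup)
open import Data.List.Membership.Propositional using (_∈_)
open import Data.Product using (Σ; _,_; proj₁; proj₂)
open import Data.Sum using (_⊎_; inj₁; inj₂)
open import Data.Unit using (tt)
open import Relation.Binary.PropositionalEquality
  using (_≡_; refl; sym; trans; cong; cong₂; subst; module ≡-Reasoning)

module CSemiringOrder (E : CSemiring) where
  open CSemiring E
  open ≡-Reasoning

  _∪_ : Subset Carrier → Subset Carrier → Subset Carrier
  (S ∪ S′) x = S x ⊎ S′ x

  _∨_ : Carrier → Carrier → Carrier
  e ∨ e′ = ⨁ (⟦ e ⟧ ∪ ⟦ e′ ⟧)

  ⨁-∪ : (S S′ : Subset Carrier) → ⨁ S ∨ ⨁ S′ ≡ ⨁ (S ∪ S′)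
  ⨁-∪ S S′ = begin
      ⨁ (⟦ ⨁ S ⟧ ∪ ⟦ ⨁ S′ ⟧)              ≡⟨ ⨁-ext _ _ toIndexed fromIndexed ⟩
      ⨁ (λ x → Σ Bool λ i → ⨁ (F i) ≡ x)  ≡⟨ ⨁-flatten Bool F ⟩
      ⨁ (λ x → Σ Bool λ i → F i x)        ≡⟨ ⨁-ext _ _ toUnion fromUnion ⟩
      ⨁ (S ∪ S′)                          ∎
    where
    F : Bool → Subset Carrier
    F true  = S
    F false = S′
    toIndexed : ∀ x → x ≡ ⨁ S ⊎ x ≡ ⨁ S′ → Σ Bool λ i → ⨁ (F i) ≡ x
    toIndexed x (inj₁ eq) = true  , sym eq
    toIndexed x (inj₂ eq) = false , sym eq
    fromIndexed : ∀ x → (Σ Bool λ i → ⨁ (F i) ≡ x) → x ≡ ⨁ S ⊎ x ≡ ⨁ S′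
    fromIndexed x (true  , eq) = inj₁ (sym eq)
    fromIndexed x (false , eq) = inj₂ (sym eq)
    toUnion : ∀ x → (Σ Bool λ i → F i x) → (S ∪ S′) x
    toUnion x (true  , s) = inj₁ s
    toUnion x (false , s) = inj₂ s
    fromUnion : ∀ x → (S ∪ S′) x → Σ Bool λ i → F i x
    fromUnion x (inj₁ s) = true  , s
    fromUnion x (inj₂ s) = false , s

  ≤-⨁ : {a : Carrier} (S : Subset Carrier) → S a → a ≤E ⨁ S
  ≤-⨁ {a} S a∈S = begin
      a ∨ ⨁ S          ≡⟨ cong (_∨ ⨁ S) (sym (⨁-singleton a)) ⟩
      ⨁ ⟦ a ⟧ ∨ ⨁ S    ≡⟨ ⨁-∪ ⟦ a ⟧ S ⟩
      ⨁ (⟦ a ⟧ ∪ S)    ≡⟨ ⨁-ext _ _ absorb (λ _ → inj₂) ⟩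
      ⨁ S              ∎
    where
    absorb : ∀ x → (⟦ a ⟧ ∪ S) x → S x
    absorb x (inj₁ refl) = a∈S
    absorb x (inj₂ x∈S)  = x∈S

  ≤E-trans : {a b c : Carrier} → a ≤E b → b ≤E c → a ≤E c
  ≤E-trans {a} {b} {c} a≤b b≤c = begin
      a ∨ c                               ≡⟨ cong₂ _∨_ (sym (⨁-singleton a)) (sym b≤c) ⟩
      ⨁ ⟦ a ⟧ ∨ ⨁ (⟦ b ⟧ ∪ ⟦ c ⟧)         ≡⟨ ⨁-∪ ⟦ a ⟧ (⟦ b ⟧ ∪ ⟦ c ⟧) ⟩
      ⨁ (⟦ a ⟧ ∪ (⟦ b ⟧ ∪ ⟦ c ⟧))         ≡⟨ ⨁-ext _ _ reassoc unreassoc ⟩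
      ⨁ ((⟦ a ⟧ ∪ ⟦ b ⟧) ∪ ⟦ c ⟧)         ≡⟨ sym (⨁-∪ (⟦ a ⟧ ∪ ⟦ b ⟧) ⟦ c ⟧) ⟩
      ⨁ (⟦ a ⟧ ∪ ⟦ b ⟧) ∨ ⨁ ⟦ c ⟧         ≡⟨ cong₂ _∨_ a≤b (⨁-singleton c) ⟩
      b ∨ c                               ≡⟨ b≤c ⟩
      c                                   ∎
    where
    reassoc : ∀ x → (⟦ a ⟧ ∪ (⟦ b ⟧ ∪ ⟦ c ⟧)) x → ((⟦ a ⟧ ∪ ⟦ b ⟧) ∪ ⟦ c ⟧) x
    reassoc x (inj₁ p)        = inj₁ (inj₁ p)
    reassoc x (inj₂ (inj₁ p)) = inj₁ (inj₂ p)
    reassoc x (inj₂ (inj₂ p)) = inj₂ p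
    unreassoc : ∀ x → ((⟦ a ⟧ ∪ ⟦ b ⟧) ∪ ⟦ c ⟧) x → (⟦ a ⟧ ∪ (⟦ b ⟧ ∪ ⟦ c ⟧)) x
    unreassoc x (inj₁ (inj₁ p)) = inj₁ p
    unreassoc x (inj₁ (inj₂ p)) = inj₂ (inj₁ p)
    unreassoc x (inj₂ p)        = inj₂ (inj₂ p)

  ≤-⋀ : {a : Carrier} (S : Subset Carrier) → (∀ y → S y → a ≤E y) → a ≤E ⋀ S
  ≤-⋀ S a-lower = ≤-⨁ _ a-lower

<ℓ-downward : {X : Set} (σ : Word X) {m n : ℕ} → m < n → n <ℓ σ → m <ℓ σ
<ℓ-downward (fin w) m<n n<|w| = <-trans m<n n<|w|
<ℓ-downward (str s) _ _       = tt

module _ {E : CSemiring} {nΣ : ℕ} (A : SCA E nΣ) where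
  open CSemiring E
  open SCA A
  open CSemiringOrder E

  record AcceptingRun (σ : Word (Fin nΣ)) : Set where
    field
      μ       : ℕ → Fin nQ
      ν       : ℕ → Carrier
      μ-init  : μ 0 ≡ q⁰
      ν-above : ∀ n → t ≤E ν n
      step    : ∀ n (p : n <ℓ σ) → (μ n , at σ n p , ν n , μ (suc n)) ∈ δ

  module _ {σ : Word (Fin nΣ)} (run : AcceptingRun σ) where
    open AcceptingRun run

    run-reaches : ∀ n → n <ℓ σ → Reach A σ n (μ n)
    run-reaches zero    _ = subst (Reach A σ 0) (sym μ-init) reach0
    run-reaches (suc n) p = reachS (run-reaches n p′) p′ (step n p′)
      where p′ = <ℓ-downward σ (n<1+n n) p

    -- ν(n) is one of the weights joined in ξ(n), so t ≤ ν(n) ≤ ξ(n).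
    run-bounds-ξ : ∀ n (p : n <ℓ σ) → t ≤E ξ A σ n p
    run-bounds-ξ n p =
      ≤E-trans (ν-above n) (≤-⨁ _ (μ n , μ (suc n) , run-reaches n p , step n p))

    run-bounds-d : t ≤E d A σ
    run-bounds-d = ≤-⋀ _ λ { _ (n , p , refl) → run-bounds-ξ n p }

  language-run : (s : ℕ → Fin nΣ) → InL A s → AcceptingRun (str s)
  language-run s (μ , ν , μ0 , valid) =
    record { μ = μ ; ν = ν ; μ-init = μ0
           ; ν-above = λ n → proj₁ (valid n) ; step = λ n _ → proj₂ (valid n) }

  prefix-run : (w : List (Fin nΣ)) → PrefixOfL A (fin w) → AcceptingRun (fin w)
  prefix-run w (τ , (μ , ν , μ0 , valid) , w≡τ) =
    record { μ = μ ; ν = ν ; μ-init = μ0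
           ; ν-above = λ n → proj₁ (valid n) ; step = step }
    where
    letter : ∀ n (p : n <ℓ fin w) → at (fin w) n p ≡ τ n
    letter n p = trans (w≡τ (fromℕ< p)) (cong τ (toℕ-fromℕ< p))
    step : ∀ n (p : n <ℓ fin w) → (μ n , at (fin w) n p , ν n , μ (suc n)) ∈ δ
    step n p = subst (λ a → (μ n , a , ν n , μ (suc n)) ∈ δ)
                     (sym (letter n p)) (proj₂ (valid n))

  accepting-run : (σ : Word (Fin nΣ)) → WordInL A σ ⊎ PrefixOfL A σ → AcceptingRun σ
  accepting-run (str s) (inj₁ s∈L)      = language-run s s∈L
  accepting-run (fin w) (inj₂ w-prefix) = prefix-run w w-prefix

lemma2 : (E : CSemiring) (nΣ : ℕ) (A : SCA E nΣ) (σ : Word (Fin nΣ)) →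
         PiOrStar σ →
         WordInL A σ ⊎ PrefixOfL A σ →
         CSemiring._≤E_ E (SCA.t A) (d A σ)
lemma2 E nΣ A σ _ membership = run-bounds-d A (accepting-run A σ membership)
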